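{- For every positive integer $N$, there are at least $N^{1/4}/2-1$ integers $u<N$ for which there exist an integer $t<u$ with $\gcd(t,u)=1$, an integer $\ell\le \frac12\log_2 N$, and $a_1,\ldots,a_\ell\in\{1,2\}$ such that $$\frac{t}{u}=[a_1,1,a_2,1,\ldots,a_\ell,1].$$
   Context: For integers $b_1,\ldots,b_m\ge 1$ ($m\ge 0$), the continued fraction $[b_1,\ldots,b_m]$ is defined as $\cfrac{1}{b_1+\cfrac{1}{\ddots+\frac{1}{b_m}}}$. Here the sequence $[a_1,1,a_2,1,\ldots,a_\ell,1]$ alternates the $a_i$ with entries equal to $1$. Logarithms are base $2$. -}

module Defs where

open import Data.Nat using (ℕ; zero; suc)
open import Data.Integer using (+_; +[1+_]; -[1+_])
open import Data.List using (List; []; _∷_)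
open import Data.Rational using (ℚ; mkℚ; 0ℚ; 1/_; _+_; _/_)

-- total reciprocal on ℚ (1/0 := 0); only ever applied to positive values below
inv : ℚ → ℚ
inv (mkℚ (+ zero) _ _) = 0ℚ
inv q@(mkℚ +[1+ _ ] _ _) = 1/ q
inv q@(mkℚ -[1+ _ ] _ _) = 1/ q

cf : List ℕ → ℚ
cf [] = 0ℚ
cf (b ∷ bs) = inv ((+ b / 1) + cf bs)

interleave1 : List ℕ → List ℕ
interleave1 [] = []
interleave1 (a ∷ as) = a ∷ 1 ∷ interleave1 as

-- the rational t/u (with t/0 := 0, never used since u > t ≥ 0)
_//_ : ℕ → ℕ → ℚ
t // zero = 0ℚ
t // suc u = (+ t) / suc u

module Submission where

-- Reading [a, 1, x] with x = t/u gives (t + u)/(a(t + u) + u), so every word a₁…aℓ over {1, 2}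
-- yields a reduced fraction t/u = [a₁,1,…,aℓ,1] with t < u and t + u ≤ 4^ℓ, and distinct words yield distinct
-- fractions. Distinct fractions may share a denominator; this is avoided by prefixing k twos. The map (t, u) ↦
-- (t', u') of a prefix is linear and unimodular, so u' = t·c + u·d with gcd(c, d) = 1, and as long as t < d the
-- denominator u' determines (t, u) and hence the word. The 2^k words 2ᵏw with w ∈ {1,2}ᵏ therefore give 2^k
-- distinct denominators below 16^k ≤ N, and choosing 16^k ≤ N < 16^(k+1) makes 2^k ≥ N^(1/4)/2.

open import Defs
open import Data.Bool using (Bool; true; false)
open import Data.Empty using (⊥-elim)
open import Data.List using (List; []; _∷_; _++_; length; foldr; replicate; map; cartesianProductWith)
open import Data.List.Properties using (length-map; length-++; length-replicate; foldr-++; map-injective)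
open import Data.List.Relation.Unary.All using (All; []; _∷_; universal)
import Data.List.Relation.Unary.All.Properties as AllP
open import Data.List.Relation.Unary.AllPairs using ([]; _∷_)
open import Data.List.Relation.Unary.Unique.Propositional using (Unique)
import Data.List.Relation.Unary.Unique.Propositional.Properties as Uniqueₚ
open import Data.Nat using (ℕ; zero; suc; _+_; _*_; _^_; _<_; _≤_; _>_; z≤n; s≤s; z<s; NonZero; >-nonZero; >-nonZero⁻¹)
open import Data.Nat.Properties
open import Data.Nat.Coprimality using (Coprime; coprime-divisor; coprime⇒gcd≡1)
open import Data.Nat.Divisibility using (_∣_; >⇒∤; ∣1⇒≡1; ∣m+n∣m⇒∣n; ∣m⇒∣m*n; ∣n⇒∣m*n; n∣m*n)
open import Data.Nat.GCD using (gcd)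
open import Data.Nat.Tactic.RingSolver using (solve-∀)
open import Data.Product using (Σ; _×_; _,_; proj₁; proj₂; map₁; uncurry; ∃-syntax)
open import Data.Product.Properties using (,-injectiveˡ; ,-injectiveʳ)
open import Data.Rational.Properties using (0/n≡0)
open import Data.Sum using (_⊎_; inj₁; inj₂)
open import Data.Vec using (Vec; toList) renaming ([] to []ᵥ; _∷_ to _∷ᵥ_)
import Data.Vec.Properties as Vec
open import Data.Vec.Properties using (toList-injective; length-toList; cast-is-id)
open import Relation.Binary.PropositionalEquality using (_≡_; refl; sym; trans; cong; cong₂; subst; module ≡-Reasoning)

-- Kept in its own scope: the integer sign +_ would make sections (m +_) of ℕ-addition ambiguous.
module _ where
  open import Data.Integer using (+_; +[1+_]; -[1+_]) renaming (_*_ to _*ℤ_; _+_ to _+ℤ_)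
  import Data.Integer.Properties as ℤ
  import Data.Integer.Tactic.RingSolver as ℤ-Solver
  open import Data.Rational using (mkℚ; toℚᵘ; _/_) renaming (_+_ to _+ℚ_)
  open import Data.Rational.Properties using (toℚᵘ-injective; toℚᵘ-fromℚᵘ; toℚᵘ-homo-+)
  open import Data.Rational.Unnormalised using (mkℚᵘ; *≡*) renaming (_≃_ to _≃ᵘ_; _+_ to _+ᵘ_)
  import Data.Rational.Unnormalised.Properties as ℚᵘ

  +-// : ∀ a t u .{{_ : NonZero u}} → + a / 1 +ℚ t // u ≡ (a * u + t) // u
  +-// a t (suc u) = toℚᵘ-injective (begin
    toℚᵘ (+ a / 1 +ℚ + t / suc u)
      ≈⟨ toℚᵘ-homo-+ (+ a / 1) (+ t / suc u) ⟩
    toℚᵘ (+ a / 1) +ᵘ toℚᵘ (+ t / suc u)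
      ≈⟨ ℚᵘ.+-cong (toℚᵘ-fromℚᵘ (mkℚᵘ (+ a) 0)) (toℚᵘ-fromℚᵘ (mkℚᵘ (+ t) u)) ⟩
    mkℚᵘ (+ a) 0 +ᵘ mkℚᵘ (+ t) u
      ≈⟨ *≡* (trans (cross-multiplied (+ a) (+ t) (+ suc u)) (sym (cong₂ _*ℤ_ numerator (ℤ.pos-* 1 (suc u))))) ⟩
    mkℚᵘ (+ (a * suc u + t)) u
      ≈⟨ toℚᵘ-fromℚᵘ (mkℚᵘ (+ (a * suc u + t)) u) ⟨
    toℚᵘ (+ (a * suc u + t) / suc u) ∎)
    where
    open ℚᵘ.≃-Reasoning
    cross-multiplied : ∀ A T U → (A *ℤ U +ℤ T *ℤ + 1) *ℤ U ≡ (A *ℤ U +ℤ T) *ℤ (+ 1 *ℤ U)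
    cross-multiplied = ℤ-Solver.solve-∀
    numerator : + (a * suc u + t) ≡ + a *ℤ + suc u +ℤ + t
    numerator = trans (ℤ.pos-+ (a * suc u) t) (cong (_+ℤ + t) (ℤ.pos-* a (suc u)))

  toℚᵘ-inv : ∀ p {n d} → toℚᵘ p ≃ᵘ mkℚᵘ +[1+ n ] d → toℚᵘ (inv p) ≃ᵘ mkℚᵘ +[1+ d ] n
  toℚᵘ-inv (mkℚ (+ zero) _ _) (*≡* ())
  toℚᵘ-inv (mkℚ +[1+ m ] e _) {n} {d} (*≡* eq) =
    *≡* (trans (ℤ.*-comm +[1+ e ] +[1+ n ]) (trans (sym eq) (ℤ.*-comm +[1+ m ] +[1+ d ])))
  toℚᵘ-inv (mkℚ -[1+ m ] e _) (*≡* ())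

  inv-// : ∀ t u .{{_ : NonZero t}} .{{_ : NonZero u}} → inv (t // u) ≡ u // t
  inv-// (suc t) (suc u) = toℚᵘ-injective (ℚᵘ.≃-trans
    (toℚᵘ-inv (+ suc t / suc u) (toℚᵘ-fromℚᵘ (mkℚᵘ (+ suc t) u)))
    (ℚᵘ.≃-sym (toℚᵘ-fromℚᵘ (mkℚᵘ (+ suc u) t))))

  cf-cons-1 : ∀ a t u xs .{{_ : NonZero u}} → cf xs ≡ t // u →
              cf (a ∷ 1 ∷ xs) ≡ (t + u) // (a * (t + u) + u)
  cf-cons-1 a t u@(suc _) xs eq = begin
    inv (+ a / 1 +ℚ inv (+ 1 / 1 +ℚ cf xs))      ≡⟨ cong (λ q → inv (+ a / 1 +ℚ inv (+ 1 / 1 +ℚ q))) eq ⟩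
    inv (+ a / 1 +ℚ inv (+ 1 / 1 +ℚ t // u))     ≡⟨ cong (λ q → inv (+ a / 1 +ℚ inv q)) (+-// 1 t u) ⟩
    inv (+ a / 1 +ℚ inv ((1 * u + t) // u))      ≡⟨ cong (λ q → inv (+ a / 1 +ℚ q)) (inv-// (1 * u + t) u) ⟩
    inv (+ a / 1 +ℚ u // (1 * u + t))            ≡⟨ cong inv (+-// a u (1 * u + t)) ⟩
    inv ((a * (1 * u + t) + u) // (1 * u + t))   ≡⟨ inv-// (a * (1 * u + t) + u) (1 * u + t) ⟩
    (1 * u + t) // (a * (1 * u + t) + u)         ≡⟨ cong (λ s → s // (a * s + u)) (trans (cong (_+ t) (*-identityˡ u)) (+-comm u t)) ⟩
    (t + u) // (a * (t + u) + u)                 ∎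
    where
    open ≡-Reasoning
    instance
      _ : NonZero (a * (1 * u + t) + u)
      _ = >-nonZero (<-≤-trans z<s (m≤n+m u _))

step : ℕ → ℕ × ℕ → ℕ × ℕ
step a (t , u) = t + u , a * (t + u) + u

act : List ℕ → ℕ × ℕ → ℕ × ℕ
act as x = foldr step x as

fraction : List ℕ → ℕ × ℕ
fraction as = act as (0 , 1)

numer denom : List ℕ → ℕ
numer as = proj₁ (fraction as)
denom as = proj₂ (fraction as)

denom>0 : ∀ as → denom as > 0
denom>0 []       = z<s
denom>0 (a ∷ as) = <-≤-trans (denom>0 as) (m≤n+m (denom as) _)

numer-∷>0 : ∀ a as → numer (a ∷ as) > 0
numer-∷>0 a as = <-≤-trans (denom>0 as) (m≤n+m (denom as) (numer as))

cf-interleave1 : ∀ as → cf (interleave1 as) ≡ numer as // denom as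
cf-interleave1 []       = sym (0/n≡0 1)
cf-interleave1 (a ∷ as) =
  cf-cons-1 a (numer as) (denom as) (interleave1 as) {{>-nonZero (denom>0 as)}} (cf-interleave1 as)

numer<denom : ∀ {as} → All NonZero as → numer as < denom as
numer<denom []                 = z<s
numer<denom {a ∷ as} (a≢0 ∷ _) =
  ≤-<-trans (m≤n*m (numer (a ∷ as)) a {{a≢0}}) (m<m+n (a * numer (a ∷ as)) (denom>0 as))

numer-denom-coprime : ∀ as → Coprime (numer as) (denom as)
numer-denom-coprime []       (_ , i∣1) = ∣1⇒≡1 i∣1
numer-denom-coprime (a ∷ as) {i} (i∣s , i∣as+u) = numer-denom-coprime as (i∣t , i∣u)
  where
  i∣u : i ∣ denom as
  i∣u = ∣m+n∣m⇒∣n i∣as+u (∣n⇒∣m*n a i∣s)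
  i∣t : i ∣ numer as
  i∣t = ∣m+n∣m⇒∣n (subst (i ∣_) (+-comm (numer as) (denom as)) i∣s) i∣u

numer+denom≤4^length : ∀ {as} → All (_≤ 2) as → numer as + denom as ≤ 4 ^ length as
numer+denom≤4^length []                 = ≤-refl
numer+denom≤4^length {a ∷ as} (a≤2 ∷ p) = begin
  s + (a * s + u)  ≤⟨ +-monoʳ-≤ s (+-mono-≤ (*-monoˡ-≤ s a≤2) (m≤n+m u t)) ⟩
  s + (2 * s + s)  ≡⟨ four-times s ⟩
  4 * s            ≤⟨ *-monoʳ-≤ 4 (numer+denom≤4^length p) ⟩
  4 ^ length (a ∷ as) ∎
  where
  open ≤-Reasoning
  t = numer as
  u = denom as
  s = t + u
  four-times : ∀ s → s + (2 * s + s) ≡ 4 * s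
  four-times = solve-∀

denom<4^length : ∀ {a as} → All (_≤ 2) (a ∷ as) → denom (a ∷ as) < 4 ^ length (a ∷ as)
denom<4^length {a} {as} p = <-≤-trans (m<n+m _ (numer-∷>0 a as)) (numer+denom≤4^length p)

m<m+n*m+o : ∀ m n {o} → o > 0 → m < m + n * m + o
m<m+n*m+o m n o>0 = <-≤-trans (m<m+n m o>0) (+-monoˡ-≤ _ (m≤m+n m (n * m)))

*+-unique : ∀ {s} a b {u v} → u > 0 → u ≤ s → v > 0 → v ≤ s → a * s + u ≡ b * s + v → a ≡ b × u ≡ v
*+-unique zero    zero    _   _   _   _   eq = refl , eq
*+-unique zero    (suc b) _   u≤s v>0 _   eq = ⊥-elim (<⇒≱ (subst (_ <_) (sym eq) (m<m+n*m+o _ b v>0)) u≤s)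
*+-unique (suc a) zero    u>0 _   _   v≤s eq = ⊥-elim (<⇒≱ (subst (_ <_) eq (m<m+n*m+o _ a u>0)) v≤s)
*+-unique {s} (suc a) (suc b) {u} {v} u>0 u≤s v>0 v≤s eq =
  map₁ (cong suc) (*+-unique a b u>0 u≤s v>0 v≤s (+-cancelˡ-≡ s _ _ (begin
    s + (a * s + u)  ≡⟨ +-assoc s (a * s) u ⟨
    s + a * s + u    ≡⟨ eq ⟩
    s + b * s + v    ≡⟨ +-assoc s (b * s) v ⟩
    s + (b * s + v)  ∎)))
  where open ≡-Reasoning

step-injective : ∀ {a b t u t′ u′} → u > 0 → u′ > 0 → step a (t , u) ≡ step b (t′ , u′) →
                 a ≡ b × (t , u) ≡ (t′ , u′)
step-injective {a} {b} {t} {u} {t′} {u′} u>0 u′>0 eq = proj₁ a≡b×u≡u′ , cong₂ _,_ t≡t′ (proj₂ a≡b×u≡u′)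
  where
  s≡s′ : t + u ≡ t′ + u′
  s≡s′ = ,-injectiveˡ eq
  a≡b×u≡u′ : a ≡ b × u ≡ u′
  a≡b×u≡u′ = *+-unique a b u>0 (subst (u ≤_) s≡s′ (m≤n+m u t)) u′>0 (m≤n+m u′ t′)
               (subst (λ s → a * s + u ≡ b * (t′ + u′) + u′) s≡s′ (,-injectiveʳ eq))
  t≡t′ : t ≡ t′
  t≡t′ = +-cancelʳ-≡ u t t′ (trans s≡s′ (cong (t′ +_) (sym (proj₂ a≡b×u≡u′))))

fraction-injective : ∀ {as bs} → fraction as ≡ fraction bs → as ≡ bs
fraction-injective {[]}     {[]}     _  = refl
fraction-injective {[]}     {b ∷ bs} eq = ⊥-elim (<⇒≢ (numer-∷>0 b bs) (,-injectiveˡ eq))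
fraction-injective {a ∷ as} {[]}     eq = ⊥-elim (<⇒≢ (numer-∷>0 a as) (sym (,-injectiveˡ eq)))
fraction-injective {a ∷ as} {b ∷ bs} eq with step-injective {a} {b} (denom>0 as) (denom>0 bs) eq
... | refl , fraction≡ = cong (a ∷_) (fraction-injective fraction≡)

act-linear : ∀ ps t u → let (c₁ , c₂) = act ps (1 , 0); (d₁ , d₂) = act ps (0 , 1) in
             act ps (t , u) ≡ (t * c₁ + u * d₁ , t * c₂ + u * d₂)
act-linear []       t u = cong₂ _,_ (unit₁ t u) (unit₂ t u)
  where
  unit₁ : ∀ t u → t ≡ t * 1 + u * 0
  unit₁ = solve-∀
  unit₂ : ∀ t u → u ≡ t * 0 + u * 1
  unit₂ = solve-∀
act-linear (p ∷ ps) t u =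
  trans (cong (step p) (act-linear ps t u)) (cong₂ _,_ (first t u c₁ c₂ d₁ d₂) (second p t u c₁ c₂ d₁ d₂))
  where
  c₁ = proj₁ (act ps (1 , 0))
  c₂ = proj₂ (act ps (1 , 0))
  d₁ = proj₁ (act ps (0 , 1))
  d₂ = proj₂ (act ps (0 , 1))
  first : ∀ t u c₁ c₂ d₁ d₂ → (t * c₁ + u * d₁) + (t * c₂ + u * d₂) ≡ t * (c₁ + c₂) + u * (d₁ + d₂)
  first = solve-∀
  second : ∀ p t u c₁ c₂ d₁ d₂ →
           p * ((t * c₁ + u * d₁) + (t * c₂ + u * d₂)) + (t * c₂ + u * d₂)
           ≡ t * (p * (c₁ + c₂) + c₂) + u * (p * (d₁ + d₂) + d₂)
  second = solve-∀

act-det : ∀ ps → let (c₁ , c₂) = act ps (1 , 0); (d₁ , d₂) = act ps (0 , 1) in c₁ * d₂ ≡ 1 + c₂ * d₁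
act-det []       = refl
act-det (p ∷ ps) = begin
  (c₁ + c₂) * (p * (d₁ + d₂) + d₂)      ≡⟨ expandˡ p c₁ c₂ d₁ d₂ ⟩
  p * ((c₁ + c₂) * (d₁ + d₂)) + c₂ * d₂ + c₁ * d₂
                                        ≡⟨ cong (p * ((c₁ + c₂) * (d₁ + d₂)) + c₂ * d₂ +_) (act-det ps) ⟩
  p * ((c₁ + c₂) * (d₁ + d₂)) + c₂ * d₂ + (1 + c₂ * d₁)
                                        ≡⟨ expandʳ p c₁ c₂ d₁ d₂ ⟩
  1 + (p * (c₁ + c₂) + c₂) * (d₁ + d₂)  ∎
  where
  open ≡-Reasoning
  c₁ = proj₁ (act ps (1 , 0))
  c₂ = proj₂ (act ps (1 , 0))
  d₁ = proj₁ (act ps (0 , 1))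
  d₂ = proj₂ (act ps (0 , 1))
  expandˡ : ∀ p c₁ c₂ d₁ d₂ →
            (c₁ + c₂) * (p * (d₁ + d₂) + d₂) ≡ p * ((c₁ + c₂) * (d₁ + d₂)) + c₂ * d₂ + c₁ * d₂
  expandˡ = solve-∀
  expandʳ : ∀ p c₁ c₂ d₁ d₂ →
            p * ((c₁ + c₂) * (d₁ + d₂)) + c₂ * d₂ + (1 + c₂ * d₁) ≡ 1 + (p * (c₁ + c₂) + c₂) * (d₁ + d₂)
  expandʳ = solve-∀

det⇒coprime : ∀ {c₁ c₂ d₁ d₂} → c₁ * d₂ ≡ 1 + c₂ * d₁ → Coprime d₂ c₂
det⇒coprime {c₁} {c₂} {d₁} det {i} (i∣d₂ , i∣c₂) =
  ∣1⇒≡1 (∣m+n∣m⇒∣n (subst (i ∣_) (trans det (+-comm 1 (c₂ * d₁))) (∣n⇒∣m*n c₁ i∣d₂)) (∣m⇒∣m*n d₁ i∣c₂))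

coprime-linear-≤ : ∀ {c d t₁ t₂ u₁ u₂} → Coprime d c → t₁ ≤ t₂ → t₂ < d →
                   t₁ * c + u₁ * d ≡ t₂ * c + u₂ * d → t₁ ≡ t₂
coprime-linear-≤ _ t₁≤t₂ _ _ with m≤n⇒∃[o]m+o≡n t₁≤t₂
coprime-linear-≤ {t₁ = t₁} _ _ _ _ | zero , refl = sym (+-identityʳ t₁)
coprime-linear-≤ {c} {d} {t₁} {u₁ = u₁} {u₂} cop _ t₂<d eq | suc δ , refl =
  ⊥-elim (>⇒∤ (≤-<-trans (m≤n+m (suc δ) t₁) t₂<d) (coprime-divisor cop d∣cδ))
  where
  shifted : t₁ * c + u₁ * d ≡ t₁ * c + (u₂ * d + c * suc δ)
  shifted = trans eq (regroup t₁ (suc δ) c u₂ d)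
    where
    regroup : ∀ t δ c u d → (t + δ) * c + u * d ≡ t * c + (u * d + c * δ)
    regroup = solve-∀
  d∣cδ : d ∣ c * suc δ
  d∣cδ = ∣m+n∣m⇒∣n (subst (d ∣_) (+-cancelˡ-≡ (t₁ * c) _ _ shifted) (n∣m*n u₁)) (n∣m*n u₂)

coprime-linear-unique : ∀ {c d t₁ t₂ u₁ u₂} → Coprime d c → t₁ < d → t₂ < d →
                        t₁ * c + u₁ * d ≡ t₂ * c + u₂ * d → t₁ ≡ t₂ × u₁ ≡ u₂
coprime-linear-unique {c} {d} {t₁} {t₂} {u₁} {u₂} cop t₁<d t₂<d eq = t₁≡t₂ , u₁≡u₂
  where
  t₁≡t₂ : t₁ ≡ t₂
  t₁≡t₂ with ≤-total t₁ t₂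
  ... | inj₁ t₁≤t₂ = coprime-linear-≤ {u₁ = u₁} {u₂} cop t₁≤t₂ t₂<d eq
  ... | inj₂ t₂≤t₁ = sym (coprime-linear-≤ {u₁ = u₂} {u₁} cop t₂≤t₁ t₁<d (sym eq))
  u₁≡u₂ : u₁ ≡ u₂
  u₁≡u₂ = *-cancelʳ-≡ u₁ u₂ d {{>-nonZero (≤-<-trans z≤n t₁<d)}}
            (+-cancelˡ-≡ (t₂ * c) _ _ (subst (λ t → t * c + u₁ * d ≡ t₂ * c + u₂ * d) t₁≡t₂ eq))

denom-++ : ∀ ps ys → denom (ps ++ ys) ≡ numer ys * proj₂ (act ps (1 , 0)) + denom ys * denom ps
denom-++ ps ys = trans (cong proj₂ (foldr-++ step (0 , 1) ps ys)) (cong proj₂ (act-linear ps (numer ys) (denom ys)))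

denom-++-injective : ∀ ps {ys zs} → numer ys < denom ps → numer zs < denom ps →
                     denom (ps ++ ys) ≡ denom (ps ++ zs) → ys ≡ zs
denom-++-injective ps {ys} {zs} ys<ps zs<ps eq = fraction-injective (uncurry (cong₂ _,_)
  (coprime-linear-unique (det⇒coprime {proj₁ (act ps (1 , 0))} (act-det ps)) ys<ps zs<ps
    (trans (sym (denom-++ ps ys)) (trans eq (denom-++ ps zs)))))

fraction-≤-replicate : ∀ {b as} → All (_≤ b) as →
                       numer as ≤ numer (replicate (length as) b) × denom as ≤ denom (replicate (length as) b)
fraction-≤-replicate []          = ≤-refl , ≤-refl
fraction-≤-replicate (a≤b ∷ p) with fraction-≤-replicate p
... | t≤ , u≤ = s≤ , +-mono-≤ (*-mono-≤ a≤b s≤) u≤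
  where s≤ = +-mono-≤ t≤ u≤

digit : Bool → ℕ
digit false = 1
digit true  = 2

digit-injective : ∀ {b c} → digit b ≡ digit c → b ≡ c
digit-injective {false} {false} _ = refl
digit-injective {true}  {true}  _ = refl

word : ∀ {k} → Vec Bool k → List ℕ
word v = map digit (toList v)

word-injective : ∀ {k} {v w : Vec Bool k} → word v ≡ word w → v ≡ w
word-injective {v = v} {w} eq =
  trans (sym (cast-is-id refl v)) (toList-injective refl v w (map-injective digit-injective eq))

All-word : ∀ {P : ℕ → Set} → (∀ b → P (digit b)) → ∀ {k} (v : Vec Bool k) → All P (word v)
All-word p v = AllP.map⁺ (universal p (toList v))

length-word : ∀ {k} (v : Vec Bool k) → length (word v) ≡ k
length-word v = trans (length-map digit (toList v)) (length-toList v)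

length-cartesianProductWith : ∀ {A B C : Set} (f : A → B → C) xs ys →
                              length (cartesianProductWith f xs ys) ≡ length xs * length ys
length-cartesianProductWith f []       ys = refl
length-cartesianProductWith f (x ∷ xs) ys = begin
  length (map (f x) ys ++ cartesianProductWith f xs ys)       ≡⟨ length-++ (map (f x) ys) ⟩
  length (map (f x) ys) + length (cartesianProductWith f xs ys)
    ≡⟨ cong₂ _+_ (length-map (f x) ys) (length-cartesianProductWith f xs ys) ⟩
  length ys + length xs * length ys                           ∎
  where open ≡-Reasoning

vectors : ∀ k → List (Vec Bool k)
vectors zero    = []ᵥ ∷ []
vectors (suc k) = cartesianProductWith _∷ᵥ_ (true ∷ false ∷ []) (vectors k)

length-vectors : ∀ k → length (vectors k) ≡ 2 ^ k
length-vectors zero    = refl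
length-vectors (suc k) =
  trans (length-cartesianProductWith _∷ᵥ_ (true ∷ false ∷ []) (vectors k)) (cong (2 *_) (length-vectors k))

vectors-unique : ∀ k → Unique (vectors k)
vectors-unique zero    = [] ∷ []
vectors-unique (suc k) = Uniqueₚ.cartesianProductWith⁺ _∷ᵥ_ Vec.∷-injective (((λ ()) ∷ []) ∷ [] ∷ []) (vectors-unique k)

digit-nonZero : ∀ b → NonZero (digit b)
digit-nonZero false = _
digit-nonZero true  = _

digit-≤2 : ∀ b → digit b ≤ 2
digit-≤2 false = s≤s z≤n
digit-≤2 true  = ≤-refl

digit-1or2 : ∀ b → digit b ≡ 1 ⊎ digit b ≡ 2
digit-1or2 false = inj₁ refl
digit-1or2 true  = inj₂ refl

prefixed-word : ∀ {k} → Vec Bool k → List ℕ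
prefixed-word {k} v = replicate k 2 ++ word v

All-prefixed-word : ∀ {P : ℕ → Set} → P 2 → (∀ b → P (digit b)) → ∀ {k} (v : Vec Bool k) → All P (prefixed-word v)
All-prefixed-word p2 p {k} v = AllP.++⁺ (AllP.replicate⁺ k p2) (All-word p v)

length-prefixed-word : ∀ {k} (v : Vec Bool k) → length (prefixed-word v) ≡ k + k
length-prefixed-word {k} v = trans (length-++ (replicate k 2)) (cong₂ _+_ (length-replicate k) (length-word v))

numer-word<denom-2s : ∀ {k} (v : Vec Bool k) → numer (word v) < denom (replicate k 2)
numer-word<denom-2s v = <-≤-trans (numer<denom (All-word digit-nonZero v))
  (subst (λ n → denom (word v) ≤ denom (replicate n 2)) (length-word v)
    (proj₂ (fraction-≤-replicate (All-word digit-≤2 v))))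

denom-prefixed-word-injective : ∀ {k} {v w : Vec Bool k} → denom (prefixed-word v) ≡ denom (prefixed-word w) → v ≡ w
denom-prefixed-word-injective {k} {v} {w} eq =
  word-injective (denom-++-injective (replicate k 2) (numer-word<denom-2s v) (numer-word<denom-2s w) eq)

Admissible : ℕ → ℕ → Set
Admissible N u = u < N ×
  Σ ℕ (λ t → t < u × gcd t u ≡ 1 ×
    Σ (List ℕ) (λ as →
      All (λ a → a ≡ 1 ⊎ a ≡ 2) as ×
      2 ^ (2 * length as) ≤ N ×
      t // u ≡ cf (interleave1 as)))

4^[k+k]≡16^k : ∀ k → 4 ^ (k + k) ≡ 16 ^ k
4^[k+k]≡16^k k = trans (cong (4 ^_) (cong (k +_) (sym (+-identityʳ k)))) (sym (^-*-assoc 4 2 k))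

16^k≡[2^k]^4 : ∀ k → 16 ^ k ≡ (2 ^ k) ^ 4
16^k≡[2^k]^4 k = trans (^-*-assoc 2 4 k) (trans (cong (2 ^_) (*-comm 4 k)) (sym (^-*-assoc 2 k 4)))

admissible : ∀ {N k} → 16 ^ suc k ≤ N → (v : Vec Bool (suc k)) → Admissible N (denom (prefixed-word v))
admissible {N} {k} 16^K≤N v =
  <-≤-trans (denom<4^length (All-prefixed-word ≤-refl digit-≤2 v)) 4^ℓ≤N ,
  numer as , numer<denom (All-prefixed-word _ digit-nonZero v) , coprime⇒gcd≡1 (numer-denom-coprime as) ,
  as , All-prefixed-word (inj₂ refl) digit-1or2 v , subst (_≤ N) (^-*-assoc 2 2 (length as)) 4^ℓ≤N ,
  sym (cf-interleave1 as)
  where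
  as = prefixed-word v
  4^ℓ≤N : 4 ^ length as ≤ N
  4^ℓ≤N = subst (_≤ N) (sym (trans (cong (4 ^_) (length-prefixed-word v)) (4^[k+k]≡16^k (suc k)))) 16^K≤N

power-bracket : ∀ b {N} → 1 < b → N > 0 → ∃[ k ] b ^ k ≤ N × N < b ^ suc k
power-bracket b {suc zero}    1<b _ = 0 , ≤-refl , subst (1 <_) (sym (*-identityʳ b)) 1<b
power-bracket b {suc (suc n)} 1<b _ with power-bracket b {suc n} 1<b z<s
... | k , b^k≤N , N<b^k+1 with m≤n⇒m<n∨m≡n N<b^k+1
...   | inj₁ N+1<b^k+1 = k , ≤-trans b^k≤N (n≤1+n _) , N+1<b^k+1
...   | inj₂ N+1≡b^k+1 = suc k , ≤-reflexive (sym N+1≡b^k+1) ,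
                          subst (_< b ^ suc (suc k)) (sym N+1≡b^k+1) (^-monoʳ-< b 1<b (n<1+n (suc k)))

theorem1p4 : (N : ℕ) → .{{_ : NonZero N}} →
    Σ (List ℕ) λ us →
      Unique us ×
      All (λ u → u < N ×
        Σ ℕ (λ t → t < u × gcd t u ≡ 1 ×
          Σ (List ℕ) (λ as →
            All (λ a → a ≡ 1 ⊎ a ≡ 2) as ×
            2 ^ (2 * length as) ≤ N ×
            t // u ≡ cf (interleave1 as)))) us ×
      N ≤ (2 * length us + 2) ^ 4
theorem1p4 N with power-bracket 16 (s≤s (s≤s z≤n)) (>-nonZero⁻¹ N)
... | zero  , _ , N<16 = [] , [] , [] , <⇒≤ N<16
... | suc k , 16^K≤N , N<16^[K+1] =
  us , Uniqueₚ.map⁺ denom-prefixed-word-injective (vectors-unique K) ,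
  AllP.map⁺ (universal (admissible 16^K≤N) (vectors K)) , N≤[2ℓ+2]^4
  where
  K = suc k
  us = map (λ v → denom (prefixed-word v)) (vectors K)
  N≤[2ℓ+2]^4 : N ≤ (2 * length us + 2) ^ 4
  N≤[2ℓ+2]^4 = begin
    N                        ≤⟨ <⇒≤ N<16^[K+1] ⟩
    16 ^ suc K               ≡⟨ 16^k≡[2^k]^4 (suc K) ⟩
    (2 * 2 ^ K) ^ 4          ≤⟨ ^-monoˡ-≤ 4 (m≤m+n (2 * 2 ^ K) 2) ⟩
    (2 * 2 ^ K + 2) ^ 4      ≡⟨ cong (λ n → (2 * n + 2) ^ 4) (trans (length-map _ (vectors K)) (length-vectors K)) ⟨
    (2 * length us + 2) ^ 4  ∎
    where open ≤-Reasoning
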